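{- Let $K$ be $\mathbb{Q}$ or a quadratic field, let $a, r \in K$ with $a \neq 0$ and $r \notin \{ -1, 1, 1-a, -1-a\}$, and put \[ b = \frac{r^2-1}{a}, \qquad c = a + b + 2r , \] so that $ab+1 = r^2$. Assume that $ab$, $ac$, $bc$ are pairwise distinct. Consider the elliptic curve \[ E' : \; y^2 = (x+ab)(x+bc)(x+ac) \] over $K$ and the point $P = [0, abc] \in E'(K)$. Then $5P = \mathcal{O}$ if and only if \[ (-4r^2+4r^4)a^4 + (4r-20r^3+16r^5)a^3 + (-1+16r^2-40r^4+24r^6)a^2 + (-4r+24r^3-36r^5+16r^7)a - 4r^2+12r^4-12r^6+4r^8 = 0 . \]
   Context: $\mathcal{O}$ denotes the point at infinity (the neutral element) of $E'$. The paper's setting is that $\{a,b,c\}$ is a Diophantine triple, i.e. three distinct nonzero elements of the field such that $ab+1$, $ac+1$, $bc+1$ are squares in the field; the hypotheses on $r$ ensure $b \neq 0$ and $c \neq 0$. -}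

module Defs where

open import Data.Nat using (ℕ; zero; suc)
open import Data.Product using (_×_; _,_; ∃)
open import Relation.Binary.PropositionalEquality using (_≡_; _≢_; refl)
open import Relation.Nullary using (Dec; yes; no; ¬_)
open import Relation.Binary.Definitions using (DecidableEquality)
open import Data.Rational as ℚ using (ℚ; 0ℚ; 1ℚ)
import Data.Rational.Properties as ℚP
open import Data.Product.Properties using (≡-dec)

-- Field operations on a carrier with decidable (propositional) equality.
-- `inv` is a total inverse with the convention inv 0 = 0 (only ever used
-- on nonzero arguments below in a way that matters).
record FieldOps : Set₁ where
  infixl 6 _+_ _-_
  infixl 7 _*_
  field
    Carrier : Set
    0# 1#   : Carrier
    _+_ _*_ : Carrier → Carrier → Carrier
    -_      : Carrier → Carrier
    inv     : Carrier → Carrier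
    _≟_     : DecidableEquality Carrier

  _-_ : Carrier → Carrier → Carrier
  x - y = x + (- y)

  _/_ : Carrier → Carrier → Carrier
  x / y = x * inv y

  #_ : ℕ → Carrier
  # zero    = 0#
  # (suc n) = 1# + # n

  _^2 : Carrier → Carrier
  x ^2 = x * x

invℚ : ℚ → ℚ
invℚ p with p ℚ.≟ 0ℚ
... | yes _  = 0ℚ
... | no p≢0 = ℚ.1/_ p {{ℚ.≢-nonZero p≢0}}

ℚ-field : FieldOps
ℚ-field = record
  { Carrier = ℚ ; 0# = 0ℚ ; 1# = 1ℚ ; _+_ = ℚ._+_ ; _*_ = ℚ._*_
  ; -_ = ℚ.-_ ; inv = invℚ ; _≟_ = ℚ._≟_ }

NonSquare : ℚ → Set
NonSquare d = ¬ (∃ λ q → q ℚ.* q ≡ d)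

-- The quadratic field ℚ(√d) = { x + y √d }, represented by pairs (x , y).
-- It is a field exactly when d is a non-square; every quadratic field is
-- isomorphic to one of these.
ℚ[√_] : ℚ → FieldOps
ℚ[√ d ] = record
  { Carrier = ℚ × ℚ
  ; 0# = (0ℚ , 0ℚ)
  ; 1# = (1ℚ , 0ℚ)
  ; _+_ = λ { (x , y) (u , v) → (x ℚ.+ u , y ℚ.+ v) }
  ; _*_ = λ { (x , y) (u , v) → (x ℚ.* u ℚ.+ d ℚ.* (y ℚ.* v) , x ℚ.* v ℚ.+ y ℚ.* u) }
  ; -_ = λ { (x , y) → (ℚ.- x , ℚ.- y) }
  ; inv = λ { (x , y) → let N = x ℚ.* x ℚ.- d ℚ.* (y ℚ.* y) in
                        (x ℚ.* invℚ N , ℚ.- y ℚ.* invℚ N) }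
  ; _≟_ = ≡-dec ℚ._≟_ ℚ._≟_ }

module EC (F : FieldOps) where
  open FieldOps F

  data Point : Set where
    𝒪  : Point
    pt : Carrier → Carrier → Point

  -- The chord-and-tangent group law on y² = x³ + a₂x² + a₄x + a₆.
  add : (a₂ a₄ a₆ : Carrier) → Point → Point → Point
  add a₂ a₄ a₆ 𝒪 Q = Q
  add a₂ a₄ a₆ P 𝒪 = P
  add a₂ a₄ a₆ (pt x₁ y₁) (pt x₂ y₂) with x₁ ≟ x₂
  ... | no _ = third ((y₂ - y₁) / (x₂ - x₁))
    where
    third : Carrier → Point
    third λ' = let x₃ = λ' ^2 - a₂ - x₁ - x₂ in pt x₃ (- (λ' * (x₃ - x₁) + y₁))
  ... | yes _ with (y₁ + y₂) ≟ 0#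
  ...   | yes _ = 𝒪
  ...   | no _  = third ((# 3 * x₁ ^2 + # 2 * a₂ * x₁ + a₄) / (# 2 * y₁))
    where
    third : Carrier → Point
    third λ' = let x₃ = λ' ^2 - a₂ - x₁ - x₂ in pt x₃ (- (λ' * (x₃ - x₁) + y₁))

  -- The curve E' : y² = (x + A)(x + B)(x + C), in Weierstrass form.
  addE' : (A B C : Carrier) → Point → Point → Point
  addE' A B C = add (A + B + C) (A * B + B * C + C * A) (A * B * C)

  smul : (A B C : Carrier) → ℕ → Point → Point
  smul A B C zero    P = 𝒪
  smul A B C (suc n) P = addE' A B C P (smul A B C n P)

  Lemma1Over : Set
  Lemma1Over =
    (a r : Carrier) →
    a ≢ 0# →
    r ≢ 1# → r ≢ - 1# → r ≢ 1# - a → r ≢ - 1# - a →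
    let b = (r ^2 - 1#) / a
        c = a + b + # 2 * r
    in a * b ≢ a * c → a * b ≢ b * c → a * c ≢ b * c →
       (smul (a * b) (b * c) (a * c) 5 (pt 0# (a * b * c)) ≡ 𝒪
         → polyZero a r)
     × (polyZero a r
         → smul (a * b) (b * c) (a * c) 5 (pt 0# (a * b * c)) ≡ 𝒪)
    where
    r² r³ r⁴ r⁵ r⁶ r⁷ r⁸ a² a³ a⁴ : Carrier → Carrier
    r² r = r * r
    r³ r = r² r * r
    r⁴ r = r³ r * r
    r⁵ r = r⁴ r * r
    r⁶ r = r⁵ r * r
    r⁷ r = r⁶ r * r
    r⁸ r = r⁷ r * r
    a² a = a * a
    a³ a = a² a * a
    a⁴ a = a³ a * a
    polyZero : Carrier → Carrier → Set
    polyZero a r =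
        (- (# 4 * r² r) + # 4 * r⁴ r) * a⁴ a
      + (# 4 * r - # 20 * r³ r + # 16 * r⁵ r) * a³ a
      + (- 1# + # 16 * r² r - # 40 * r⁴ r + # 24 * r⁶ r) * a² a
      + (- (# 4 * r) + # 24 * r³ r - # 36 * r⁵ r + # 16 * r⁷ r) * a
      - # 4 * r² r + # 12 * r⁴ r - # 12 * r⁶ r + # 4 * r⁸ r
      ≡ 0#

open EC using (Lemma1Over) public

-- With l = a + b + r and y = abc, the relation ab = r² - 1 makes E' a curve with
-- a₂ = l² - 1 and a₄ = 2yl: l is the tangent slope at P = (0, y) and 2P = (1, -(l + y)).
-- The chord through P and 2P then gives x(3P) = 4y(l + y).  Since 5P = 𝒪 means
-- 4P = -P, i.e. x(4P) = 0, and x(4P)·x(3P)² = 4y²(1 - x(3P)), we get 5P = 𝒪 exactly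
-- when 4y(l + y) = 1.  Multiplying 4y(l + y) - 1 by a² and eliminating b through
-- ab = r² - 1 yields the polynomial of the statement.
module Submission where

open import Defs
open import Level using (0ℓ)
open import Data.Nat as ℕ using (ℕ; zero; suc)
import Data.Nat.Properties as ℕ
open import Data.Integer as ℤ using (ℤ; +_; -[1+_])
import Data.Integer.Properties as ℤ
open import Data.Rational as ℚ using (ℚ; 0ℚ; 1ℚ)
import Data.Rational.Properties as ℚ
open import Data.Rational.Solver using (module +-*-Solver)
open import Data.Sign as Sign using (Sign)
open import Data.Maybe using (map)
open import Data.Product using (_×_; _,_)
open import Data.Sum using (_⊎_; inj₁; inj₂; reduce)
open import Data.Empty using (⊥-elim)
open import Function using (_∘_; _⇔_; mk⇔; Equivalence)
open import Function.Properties.Equivalence using () renaming (trans to ⇔-trans; sym to ⇔-sym)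
open import Relation.Binary.PropositionalEquality
  using (_≡_; _≢_; refl; sym; trans; cong; cong₂; subst; isEquivalence; module ≡-Reasoning)
open import Relation.Nullary using (yes; no; contradiction)
open import Relation.Nullary.Decidable using (dec⇒maybe)
open import Algebra.Bundles using (CommutativeRing)
open import Algebra.Structures using (IsCommutativeRing)
import Algebra.Solver.Ring.AlmostCommutativeRing as ACR
import Algebra.Solver.Ring as RingSolver

module IntegerCoefficients {c ℓ} (R : CommutativeRing c ℓ) where

  open import Algebra.Properties.Ring (CommutativeRing.ring R)
    using (-1*x≈-x; -0#≈0#; -‿involutive)
  open import Algebra.Properties.AbelianGroup (CommutativeRing.+-abelianGroup R)
    using (⁻¹-∙-comm)
  open import Algebra.Properties.CommutativeSemigroup (CommutativeRing.+-commutativeSemigroup R)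
    using () renaming (interchange to +-interchange)
  open import Algebra.Properties.CommutativeSemigroup (CommutativeRing.*-commutativeSemigroup R)
    using () renaming (interchange to *-interchange)
  open CommutativeRing R hiding (refl; sym; trans)
  open CommutativeRing R using () renaming (refl to ≈-refl; sym to ≈-sym; trans to ≈-trans)
  open import Algebra.Properties.Semiring.Mult semiring
    using (×-homo-+; ×1-homo-*) renaming (_×_ to _·_)
  open import Relation.Binary.Reasoning.Setoid setoid

  fromℤ : ℤ → Carrier
  fromℤ (+ n)    = n · 1#
  fromℤ -[1+ n ] = - (suc n · 1#)

  fromSign : Sign → Carrier
  fromSign Sign.+ = 1#
  fromSign Sign.- = - 1#

  fromℤ-⊖ : ∀ m n → fromℤ (m ℤ.⊖ n) ≈ m · 1# - n · 1#
  fromℤ-⊖ m       zero    = ≈-sym (≈-trans (+-congˡ -0#≈0#) (+-identityʳ _))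
  fromℤ-⊖ zero    (suc n) = ≈-sym (+-identityˡ _)
  fromℤ-⊖ (suc m) (suc n) = begin
    fromℤ (suc m ℤ.⊖ suc n)          ≡⟨ cong fromℤ (ℤ.[1+m]⊖[1+n]≡m⊖n m n) ⟩
    fromℤ (m ℤ.⊖ n)                  ≈⟨ fromℤ-⊖ m n ⟩
    m · 1# - n · 1#                  ≈⟨ +-identityˡ _ ⟨
    0# + (m · 1# - n · 1#)           ≈⟨ +-congʳ (-‿inverseʳ 1#) ⟨
    (1# - 1#) + (m · 1# - n · 1#)    ≈⟨ +-interchange 1# (- 1#) (m · 1#) (- (n · 1#)) ⟩
    (1# + m · 1#) + (- 1# - n · 1#)  ≈⟨ +-congˡ (⁻¹-∙-comm 1# (n · 1#)) ⟩
    (1# + m · 1#) - (1# + n · 1#)    ∎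

  fromℤ-homo-+ : ∀ i j → fromℤ (i ℤ.+ j) ≈ fromℤ i + fromℤ j
  fromℤ-homo-+ (+ m)    (+ n)    = ×-homo-+ 1# m n
  fromℤ-homo-+ (+ m)    -[1+ n ] = fromℤ-⊖ m (suc n)
  fromℤ-homo-+ -[1+ m ] (+ n)    = ≈-trans (fromℤ-⊖ n (suc m)) (+-comm _ _)
  fromℤ-homo-+ -[1+ m ] -[1+ n ] = begin
    - (suc (suc (m ℕ.+ n)) · 1#)     ≡⟨ cong (λ k → - (k · 1#)) (ℕ.+-suc (suc m) n) ⟨
    - ((suc m ℕ.+ suc n) · 1#)       ≈⟨ -‿cong (×-homo-+ 1# (suc m) (suc n)) ⟩
    - (suc m · 1# + suc n · 1#)      ≈⟨ ⁻¹-∙-comm _ _ ⟨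
    - (suc m · 1#) - suc n · 1#      ∎

  fromℤ-homo-- : ∀ i → fromℤ (ℤ.- i) ≈ - fromℤ i
  fromℤ-homo-- (+ zero)  = ≈-sym -0#≈0#
  fromℤ-homo-- (+ suc n) = ≈-refl
  fromℤ-homo-- -[1+ n ]  = ≈-sym (-‿involutive _)

  fromℤ-◃ : ∀ s n → fromℤ (s ℤ.◃ n) ≈ fromSign s * n · 1#
  fromℤ-◃ s      zero    = ≈-sym (zeroʳ _)
  fromℤ-◃ Sign.+ (suc n) = ≈-sym (*-identityˡ _)
  fromℤ-◃ Sign.- (suc n) = ≈-sym (-1*x≈-x _)

  fromℤ-signAbs : ∀ i → fromℤ i ≈ fromSign (ℤ.sign i) * ℤ.∣ i ∣ · 1#
  fromℤ-signAbs (+ n)    = ≈-sym (*-identityˡ _)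
  fromℤ-signAbs -[1+ n ] = ≈-sym (-1*x≈-x _)

  fromSign-homo-* : ∀ s t → fromSign (s Sign.* t) ≈ fromSign s * fromSign t
  fromSign-homo-* Sign.+ t      = ≈-sym (*-identityˡ _)
  fromSign-homo-* Sign.- Sign.+ = ≈-sym (*-identityʳ _)
  fromSign-homo-* Sign.- Sign.- = ≈-sym (≈-trans (-1*x≈-x (- 1#)) (-‿involutive 1#))

  fromℤ-homo-* : ∀ i j → fromℤ (i ℤ.* j) ≈ fromℤ i * fromℤ j
  fromℤ-homo-* i j = begin
    fromℤ (i ℤ.* j)
      ≈⟨ fromℤ-◃ (s Sign.* t) (∣i∣ ℕ.* ∣j∣) ⟩
    fromSign (s Sign.* t) * (∣i∣ ℕ.* ∣j∣) · 1#
      ≈⟨ *-cong (fromSign-homo-* s t) (×1-homo-* ∣i∣ ∣j∣) ⟩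
    (fromSign s * fromSign t) * (∣i∣ · 1# * ∣j∣ · 1#)
      ≈⟨ *-interchange _ _ _ _ ⟩
    (fromSign s * ∣i∣ · 1#) * (fromSign t * ∣j∣ · 1#)
      ≈⟨ *-cong (fromℤ-signAbs i) (fromℤ-signAbs j) ⟨
    fromℤ i * fromℤ j
      ∎
    where
    s t : Sign
    s = ℤ.sign i
    t = ℤ.sign j
    ∣i∣ ∣j∣ : ℕ
    ∣i∣ = ℤ.∣ i ∣
    ∣j∣ = ℤ.∣ j ∣

  homomorphism : ℤ.+-*-rawRing ACR.-Raw-AlmostCommutative⟶ ACR.fromCommutativeRing R
  homomorphism = record
    { ⟦_⟧    = fromℤ
    ; +-homo = fromℤ-homo-+
    ; *-homo = fromℤ-homo-*
    ; -‿homo = fromℤ-homo--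
    ; 0-homo = ≈-refl
    ; 1-homo = +-identityʳ 1#
    }

  open RingSolver ℤ.+-*-rawRing (ACR.fromCommutativeRing R) homomorphism
    (λ i j → map (reflexive ∘ cong fromℤ) (dec⇒maybe (i ℤ.≟ j))) public
    using (Polynomial; solve; _:=_; _:+_; _:*_; _:-_; :-_; _:^_; con)

-- The characteristic is assumed to be different from 2: doubling a point
-- divides by 2y.
record IsField (F : FieldOps) : Set where
  open FieldOps F
  field
    isCommutativeRing : IsCommutativeRing _≡_ _+_ _*_ -_ 0# 1#
    *-inverseʳ        : ∀ x → x ≢ 0# → x * inv x ≡ 1#
    2≢0               : # 2 ≢ 0#

module FieldProperties {F : FieldOps} (isField : IsField F) where

  open FieldOps F
  open IsField isField public

  commutativeRing : CommutativeRing 0ℓ 0ℓ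
  commutativeRing = record { isCommutativeRing = isCommutativeRing }

  open CommutativeRing commutativeRing public
    using (*-identityˡ; *-identityʳ; *-assoc; *-comm; zeroˡ; zeroʳ)
  open import Algebra.Properties.Group (CommutativeRing.+-group commutativeRing) public
    using (x∙y⁻¹≈ε⇒x≈y)
  open IntegerCoefficients commutativeRing public
    using (Polynomial; solve; _:=_; _:+_; _:*_; _:-_; :-_; _:^_; con)
  open ≡-Reasoning

  κ : ∀ {n} → ℕ → Polynomial n
  κ k = con (+ k)

  -- κ 1 denotes # 1 = 1# + 0#, while 𝟙 denotes 1# itself.
  𝟙 : ∀ {n} → Polynomial n
  𝟙 = κ 0 :^ 0

  x*y≡0⇒y≡0 : ∀ {x y} → x ≢ 0# → x * y ≡ 0# → y ≡ 0#
  x*y≡0⇒y≡0 {x} {y} x≢0 x*y≡0 = begin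
    y                  ≡⟨ *-identityˡ y ⟨
    1# * y             ≡⟨ cong (_* y) (trans (*-comm (inv x) x) (*-inverseʳ x x≢0)) ⟨
    (inv x * x) * y    ≡⟨ *-assoc (inv x) x y ⟩
    inv x * (x * y)    ≡⟨ cong (inv x *_) x*y≡0 ⟩
    inv x * 0#         ≡⟨ zeroʳ (inv x) ⟩
    0#                 ∎

  x*y≡0⇒x≡0⊎y≡0 : ∀ x y → x * y ≡ 0# → x ≡ 0# ⊎ y ≡ 0#
  x*y≡0⇒x≡0⊎y≡0 x y x*y≡0 with x ≟ 0#
  ... | yes x≡0 = inj₁ x≡0
  ... | no x≢0  = inj₂ (x*y≡0⇒y≡0 x≢0 x*y≡0)

  *-≢0 : ∀ {x y} → x ≢ 0# → y ≢ 0# → x * y ≢ 0#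
  *-≢0 x≢0 y≢0 = y≢0 ∘ x*y≡0⇒y≡0 x≢0

  x/y*y≡x : ∀ x {y} → y ≢ 0# → x / y * y ≡ x
  x/y*y≡x x {y} y≢0 = begin
    x * inv y * y      ≡⟨ *-assoc x (inv y) y ⟩
    x * (inv y * y)    ≡⟨ cong (x *_) (trans (*-comm (inv y) y) (*-inverseʳ y y≢0)) ⟩
    x * 1#             ≡⟨ *-identityʳ x ⟩
    x                  ∎

  x*y/y≡x : ∀ x {y} → y ≢ 0# → (x * y) / y ≡ x
  x*y/y≡x x {y} y≢0 = begin
    x * y * inv y      ≡⟨ *-assoc x y (inv y) ⟩
    x * (y * inv y)    ≡⟨ cong (x *_) (*-inverseʳ y y≢0) ⟩
    x * 1#             ≡⟨ *-identityʳ x ⟩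
    x                  ∎

  1≢0 : 1# ≢ 0#
  1≢0 1≡0 = 2≢0 (begin
    # 2        ≡⟨ solve 0 (κ 2 := 𝟙 :* κ 2) refl ⟩
    1# * # 2   ≡⟨ cong (_* # 2) 1≡0 ⟩
    0# * # 2   ≡⟨ zeroˡ (# 2) ⟩
    0#         ∎)

  4≢0 : # 4 ≢ 0#
  4≢0 = *-≢0 2≢0 2≢0 ∘ trans (solve 0 (κ 2 :* κ 2 := κ 4) refl)

  x-0≡x : ∀ x → x - 0# ≡ x
  x-0≡x = solve 1 (λ x → x :- κ 0 := x) refl

  x+y≡z⇒y≡z-x : ∀ {x y z} → x + y ≡ z → y ≡ z - x
  x+y≡z⇒y≡z-x {x} {y} x+y≡z =
    trans (solve 2 (λ x y → y := (x :+ y) :- x) refl x y) (cong (_- x) x+y≡z)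

  x*x≡1⇒x≡±1 : ∀ x → x * x ≡ 1# → x ≡ 1# ⊎ x ≡ - 1#
  x*x≡1⇒x≡±1 x x*x≡1 with x*y≡0⇒x≡0⊎y≡0 (x - 1#) (x + 1#) [x-1][x+1]≡0
    where
    [x-1][x+1]≡0 : (x - 1#) * (x + 1#) ≡ 0#
    [x-1][x+1]≡0 = begin
      (x - 1#) * (x + 1#)  ≡⟨ solve 1 (λ x → (x :- 𝟙) :* (x :+ 𝟙) := x :* x :- 𝟙) refl x ⟩
      x * x - 1#           ≡⟨ cong (_- 1#) x*x≡1 ⟩
      1# - 1#              ≡⟨ solve 0 (𝟙 :- 𝟙 := κ 0) refl ⟩
      0#                   ∎
  ... | inj₁ x-1≡0 = inj₁ (x∙y⁻¹≈ε⇒x≈y x 1# x-1≡0)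
  ... | inj₂ x+1≡0 = inj₂ (x∙y⁻¹≈ε⇒x≈y x (- 1#)
                             (trans (solve 1 (λ x → x :- :- 𝟙 := x :+ 𝟙) refl x) x+1≡0))

module Weierstrass (F : FieldOps) (a₂ a₄ a₆ : FieldOps.Carrier F) where

  open FieldOps F
  open EC F using (Point; 𝒪; pt; add)

  infixr 5 _⊕_
  _⊕_ : Point → Point → Point
  _⊕_ = add a₂ a₄ a₆

  addWithSlope : (x₁ y₁ x₂ slope : Carrier) → Point
  addWithSlope x₁ y₁ x₂ slope =
    let x₃ = slope ^2 - a₂ - x₁ - x₂ in pt x₃ (- (slope * (x₃ - x₁) + y₁))

  tangentSlope : Carrier → Carrier → Carrier
  tangentSlope x y = (# 3 * x ^2 + # 2 * a₂ * x + a₄) / (# 2 * y)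

  ⊕-chord : ∀ {x₁ y₁ x₂ y₂} → x₁ ≢ x₂ →
            pt x₁ y₁ ⊕ pt x₂ y₂ ≡ addWithSlope x₁ y₁ x₂ ((y₂ - y₁) / (x₂ - x₁))
  ⊕-chord {x₁} {_} {x₂} x₁≢x₂ with x₁ ≟ x₂
  ... | yes x₁≡x₂ = contradiction x₁≡x₂ x₁≢x₂
  ... | no _      = refl

  ⊕-tangent : ∀ {x₁ y₁ x₂ y₂} → x₁ ≡ x₂ → y₁ + y₂ ≢ 0# →
              pt x₁ y₁ ⊕ pt x₂ y₂ ≡ addWithSlope x₁ y₁ x₂ (tangentSlope x₁ y₁)
  ⊕-tangent {x₁} {y₁} {x₂} {y₂} x₁≡x₂ y₁+y₂≢0 with x₁ ≟ x₂
  ... | no x₁≢x₂ = contradiction x₁≡x₂ x₁≢x₂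
  ... | yes _ with (y₁ + y₂) ≟ 0#
  ...   | yes y₁+y₂≡0 = contradiction y₁+y₂≡0 y₁+y₂≢0
  ...   | no _        = refl

  ⊕-opposite : ∀ {x₁ y₁ x₂ y₂} → x₁ ≡ x₂ → y₁ + y₂ ≡ 0# →
               pt x₁ y₁ ⊕ pt x₂ y₂ ≡ 𝒪
  ⊕-opposite {x₁} {y₁} {x₂} {y₂} x₁≡x₂ y₁+y₂≡0 with x₁ ≟ x₂
  ... | no x₁≢x₂ = contradiction x₁≡x₂ x₁≢x₂
  ... | yes _ with (y₁ + y₂) ≟ 0#
  ...   | yes _         = refl
  ...   | no y₁+y₂≢0    = contradiction y₁+y₂≡0 y₁+y₂≢0

  pt≢𝒪 : ∀ {x y} → pt x y ≢ 𝒪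
  pt≢𝒪 ()

  ⊕≡𝒪⇒x₁≡x₂ : ∀ {x₁ y₁ x₂ y₂} → pt x₁ y₁ ⊕ pt x₂ y₂ ≡ 𝒪 → x₁ ≡ x₂
  ⊕≡𝒪⇒x₁≡x₂ {x₁} {_} {x₂} sum≡𝒪 with x₁ ≟ x₂
  ... | yes x₁≡x₂ = x₁≡x₂
  ... | no _ with sum≡𝒪
  ...   | ()

-- a₄ = 2yl makes l the tangent slope at P = (0, y), and a₂ = l² - 1 makes x(2P) = 1.
module FiveTorsion {F : FieldOps} (isField : IsField F) (a₆ y l : FieldOps.Carrier F)
                   (y≢0 : y ≢ FieldOps.0# F) where

  open FieldOps F
  open EC F using (Point; 𝒪; pt)
  open FieldProperties isField
  open ≡-Reasoning

  a₂ a₄ : Carrier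
  a₂ = l * l - 1#
  a₄ = # 2 * y * l

  open Weierstrass F a₂ a₄ a₆

  P : Point
  P = pt 0# y

  x₃ y₃ : Carrier
  x₃ = # 4 * y * (l + y)
  y₃ = (l + # 2 * y) * x₃ - y

  tangentSlope-P : tangentSlope 0# y ≡ l
  tangentSlope-P = trans (cong (_/ (# 2 * y)) numerator) (x*y/y≡x l (*-≢0 2≢0 y≢0))
    where
    numerator : # 3 * 0# ^2 + # 2 * a₂ * 0# + a₄ ≡ l * (# 2 * y)
    numerator = solve 2 (λ y l → κ 3 :* (κ 0 :* κ 0) :+ κ 2 :* (l :* l :- 𝟙) :* κ 0
                                   :+ κ 2 :* y :* l
                                 := l :* (κ 2 :* y)) refl y l

  2P≡ : P ⊕ P ≡ pt 1# (- (l + y))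
  2P≡ = begin
    P ⊕ P                                      ≡⟨ ⊕-tangent refl y+y≢0 ⟩
    addWithSlope 0# y 0# (tangentSlope 0# y)   ≡⟨ cong (addWithSlope 0# y 0#) tangentSlope-P ⟩
    addWithSlope 0# y 0# l                     ≡⟨ cong₂ pt x≡ y≡ ⟩
    pt 1# (- (l + y))                          ∎
    where
    y+y≢0 : y + y ≢ 0#
    y+y≢0 = *-≢0 2≢0 y≢0 ∘ trans (solve 1 (λ y → κ 2 :* y := y :+ y) refl y)
    x≡ : l ^2 - a₂ - 0# - 0# ≡ 1#
    x≡ = solve 1 (λ l → l :* l :- (l :* l :- 𝟙) :- κ 0 :- κ 0 := 𝟙) refl l
    y≡ : - (l * ((l ^2 - a₂ - 0# - 0#) - 0#) + y) ≡ - (l + y)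
    y≡ = solve 2 (λ y l → :- (l :* ((l :* l :- (l :* l :- 𝟙) :- κ 0 :- κ 0) :- κ 0) :+ y)
                         := :- (l :+ y)) refl y l

  3P≡ : P ⊕ P ⊕ P ≡ pt x₃ y₃
  3P≡ = begin
    P ⊕ P ⊕ P                                   ≡⟨ cong (P ⊕_) 2P≡ ⟩
    P ⊕ pt 1# (- (l + y))                       ≡⟨ ⊕-chord (1≢0 ∘ sym) ⟩
    addWithSlope 0# y 1# (rise / (1# - 0#))     ≡⟨ cong (addWithSlope 0# y 1#) slope≡ ⟩
    addWithSlope 0# y 1# (- (l + # 2 * y))      ≡⟨ cong₂ pt x≡ y≡ ⟩
    pt x₃ y₃                                    ∎
    where
    rise : Carrier
    rise = - (l + y) - y
    slope≡ : rise / (1# - 0#) ≡ - (l + # 2 * y)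
    slope≡ = trans (cong (_/ (1# - 0#)) rise≡)
                   (x*y/y≡x _ (1≢0 ∘ trans (sym (x-0≡x 1#))))
      where
      rise≡ : rise ≡ - (l + # 2 * y) * (1# - 0#)
      rise≡ = solve 2 (λ y l → :- (l :+ y) :- y := :- (l :+ κ 2 :* y) :* (𝟙 :- κ 0)) refl y l
    x≡ : (- (l + # 2 * y)) ^2 - a₂ - 0# - 1# ≡ x₃
    x≡ = solve 2 (λ y l → let m = l :+ κ 2 :* y in
                         (:- m) :* (:- m) :- (l :* l :- 𝟙) :- κ 0 :- 𝟙 := κ 4 :* y :* (l :+ y)) refl y l
    y≡ : - (- (l + # 2 * y) * (((- (l + # 2 * y)) ^2 - a₂ - 0# - 1#) - 0#) + y) ≡ y₃
    y≡ = trans (cong (λ x → - (- (l + # 2 * y) * (x - 0#) + y)) x≡)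
               (solve 3 (λ y l x → let m = l :+ κ 2 :* y in
                                     :- (:- m :* (x :- κ 0) :+ y) := m :* x :- y) refl y l x₃)

  slope₄ x₄ y₄ : Carrier
  slope₄ = (y₃ - y) / (x₃ - 0#)
  x₄ = slope₄ ^2 - a₂ - 0# - x₃
  y₄ = - (slope₄ * (x₄ - 0#) + y)

  4P≡chord : x₃ ≢ 0# → P ⊕ pt x₃ y₃ ≡ pt x₄ y₄
  4P≡chord x₃≢0 = ⊕-chord (x₃≢0 ∘ sym)

  -- Multiplying by x₃² clears the denominator of slope₄ = (y₃ - y)/x₃.
  x₄x₃²≡4y²[1-x₃] : x₃ ≢ 0# → x₄ * (x₃ * x₃) ≡ # 4 * y * y * (1# - x₃)
  x₄x₃²≡4y²[1-x₃] x₃≢0 = begin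
    x₄ * (x₃ * x₃)
      ≡⟨ expand ⟩
    (slope₄ * x₃) * (slope₄ * x₃) - (a₂ + x₃) * (x₃ * x₃)
      ≡⟨ cong (λ t → t * t - (a₂ + x₃) * (x₃ * x₃)) slope₄*x₃≡ ⟩
    (y₃ - y) * (y₃ - y) - (a₂ + x₃) * (x₃ * x₃)
      ≡⟨ collect ⟩
    # 4 * y * y * (1# - x₃)
      ∎
    where
    slope₄*x₃≡ : slope₄ * x₃ ≡ y₃ - y
    slope₄*x₃≡ = trans (cong (slope₄ *_) (sym (x-0≡x x₃)))
                       (x/y*y≡x _ (x₃≢0 ∘ trans (sym (x-0≡x x₃))))
    expand : x₄ * (x₃ * x₃) ≡ (slope₄ * x₃) * (slope₄ * x₃) - (a₂ + x₃) * (x₃ * x₃)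
    expand = solve 3 (λ s l x → let a₂ = l :* l :- 𝟙 in
                         (s :* s :- a₂ :- κ 0 :- x) :* (x :* x)
                         := (s :* x) :* (s :* x) :- (a₂ :+ x) :* (x :* x)) refl slope₄ l x₃
    collect : (y₃ - y) * (y₃ - y) - (a₂ + x₃) * (x₃ * x₃) ≡ # 4 * y * y * (1# - x₃)
    collect = solve 2 (λ y l → let x = κ 4 :* y :* (l :+ y)
                                   d = (l :+ κ 2 :* y) :* x :- y :- y in
                         d :* d :- ((l :* l :- 𝟙) :+ x) :* (x :* x)
                         := κ 4 :* y :* y :* (𝟙 :- x)) refl y l

  x₄≡0⇔x₃≡1 : x₃ ≢ 0# → x₄ ≡ 0# ⇔ x₃ ≡ 1#
  x₄≡0⇔x₃≡1 x₃≢0 = mk⇔ to from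
    where
    4y²≢0 : # 4 * y * y ≢ 0#
    4y²≢0 = *-≢0 (*-≢0 4≢0 y≢0) y≢0
    to : x₄ ≡ 0# → x₃ ≡ 1#
    to x₄≡0 = sym (x∙y⁻¹≈ε⇒x≈y 1# x₃ (x*y≡0⇒y≡0 4y²≢0 (begin
      # 4 * y * y * (1# - x₃)  ≡⟨ x₄x₃²≡4y²[1-x₃] x₃≢0 ⟨
      x₄ * (x₃ * x₃)           ≡⟨ cong (_* (x₃ * x₃)) x₄≡0 ⟩
      0# * (x₃ * x₃)           ≡⟨ zeroˡ _ ⟩
      0#                       ∎)))
    from : x₃ ≡ 1# → x₄ ≡ 0#
    from x₃≡1 = x*y≡0⇒y≡0 (*-≢0 x₃≢0 x₃≢0) (begin
      x₃ * x₃ * x₄             ≡⟨ *-comm (x₃ * x₃) x₄ ⟩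
      x₄ * (x₃ * x₃)           ≡⟨ x₄x₃²≡4y²[1-x₃] x₃≢0 ⟩
      # 4 * y * y * (1# - x₃)  ≡⟨ cong (λ x → # 4 * y * y * (1# - x)) x₃≡1 ⟩
      # 4 * y * y * (1# - 1#)  ≡⟨ solve 1 (λ y → κ 4 :* y :* y :* (𝟙 :- 𝟙) := κ 0) refl y ⟩
      0#                       ∎)

  x₃≡0⇒5P≢𝒪 : x₃ ≡ 0# → P ⊕ P ⊕ pt x₃ y₃ ≢ 𝒪
  x₃≡0⇒5P≢𝒪 x₃≡0 with (y + y₃) ≟ 0#
  ... | yes y+y₃≡0 = λ 5P≡𝒪 →
          pt≢𝒪 (trans (cong (P ⊕_) (sym (⊕-opposite (sym x₃≡0) y+y₃≡0))) 5P≡𝒪)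
  ... | no y+y₃≢0  = λ 5P≡𝒪 →
          1≢0 (trans (sym x[4P]≡1)
                     (sym (⊕≡𝒪⇒x₁≡x₂ (trans (cong (P ⊕_) (sym 4P≡tangent)) 5P≡𝒪))))
    where
    4P≡tangent : P ⊕ pt x₃ y₃ ≡ addWithSlope 0# y x₃ l
    4P≡tangent = trans (⊕-tangent (sym x₃≡0) y+y₃≢0)
                       (cong (addWithSlope 0# y x₃) tangentSlope-P)
    x[4P]≡1 : l ^2 - a₂ - 0# - x₃ ≡ 1#
    x[4P]≡1 = trans (solve 2 (λ l x → l :* l :- (l :* l :- 𝟙) :- κ 0 :- x := 𝟙 :- x)
                           refl l x₃)
                    (trans (cong (λ x → 1# - x) x₃≡0) (x-0≡x 1#))

  5P≡𝒪⇔x₄≡0 : x₃ ≢ 0# → P ⊕ P ⊕ pt x₃ y₃ ≡ 𝒪 ⇔ x₄ ≡ 0#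
  5P≡𝒪⇔x₄≡0 x₃≢0 = mk⇔ to from
    where
    to : P ⊕ P ⊕ pt x₃ y₃ ≡ 𝒪 → x₄ ≡ 0#
    to 5P≡𝒪 = sym (⊕≡𝒪⇒x₁≡x₂ (trans (cong (P ⊕_) (sym (4P≡chord x₃≢0))) 5P≡𝒪))
    from : x₄ ≡ 0# → P ⊕ P ⊕ pt x₃ y₃ ≡ 𝒪
    from x₄≡0 = trans (cong (P ⊕_) (4P≡chord x₃≢0)) (⊕-opposite (sym x₄≡0) y+y₄≡0)
      where
      y+y₄≡0 : y + y₄ ≡ 0#
      y+y₄≡0 = trans (cong (λ x → y + - (slope₄ * (x - 0#) + y)) x₄≡0)
                     (solve 2 (λ y s → y :+ :- (s :* (κ 0 :- κ 0) :+ y) := κ 0) refl y slope₄)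

  5P≡𝒪⇔x₃≡1 : P ⊕ P ⊕ P ⊕ P ⊕ P ≡ 𝒪 ⇔ x₃ ≡ 1#
  5P≡𝒪⇔x₃≡1 = subst (λ Q → P ⊕ P ⊕ Q ≡ 𝒪 ⇔ x₃ ≡ 1#) (sym 3P≡) by-x₃
    where
    by-x₃ : P ⊕ P ⊕ pt x₃ y₃ ≡ 𝒪 ⇔ x₃ ≡ 1#
    by-x₃ with x₃ ≟ 0#
    ... | yes x₃≡0 = mk⇔ (⊥-elim ∘ x₃≡0⇒5P≢𝒪 x₃≡0)
                         (λ x₃≡1 → contradiction (trans (sym x₃≡1) x₃≡0) 1≢0)
    ... | no x₃≢0  = ⇔-trans (5P≡𝒪⇔x₄≡0 x₃≢0) (x₄≡0⇔x₃≡1 x₃≢0)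

module DiophantineCurve {F : FieldOps} (isField : IsField F) (a r : FieldOps.Carrier F)
                        (a≢0 : a ≢ FieldOps.0# F) where

  open FieldOps F
  open EC F using (Point; 𝒪; pt; smul)
  open FieldProperties isField
  open ≡-Reasoning

  b c y l x₃ : Carrier
  b = (r ^2 - 1#) / a
  c = a + b + # 2 * r
  y = a * b * c
  l = a + b + r
  x₃ = # 4 * y * (l + y)

  torsionPolynomial : Carrier
  torsionPolynomial =
        (- (# 4 * r²) + # 4 * r⁴) * a⁴
      + (# 4 * r - # 20 * r³ + # 16 * r⁵) * a³
      + (- 1# + # 16 * r² - # 40 * r⁴ + # 24 * r⁶) * a²
      + (- (# 4 * r) + # 24 * r³ - # 36 * r⁵ + # 16 * r⁷) * a
      - # 4 * r² + # 12 * r⁴ - # 12 * r⁶ + # 4 * r⁸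
    where
    r² r³ r⁴ r⁵ r⁶ r⁷ r⁸ a² a³ a⁴ : Carrier
    r² = r * r
    r³ = r² * r
    r⁴ = r³ * r
    r⁵ = r⁴ * r
    r⁶ = r⁵ * r
    r⁷ = r⁶ * r
    r⁸ = r⁷ * r
    a² = a * a
    a³ = a² * a
    a⁴ = a³ * a

  ab≡r²-1 : a * b ≡ r * r - 1#
  ab≡r²-1 = trans (*-comm a b) (x/y*y≡x _ a≢0)

  b≢0 : r ≢ 1# → r ≢ - 1# → b ≢ 0#
  b≢0 r≢1 r≢-1 b≡0 with x*x≡1⇒x≡±1 r r²≡1
    where
    r²≡1 : r * r ≡ 1#
    r²≡1 = x∙y⁻¹≈ε⇒x≈y (r * r) 1#
             (trans (sym ab≡r²-1) (trans (cong (a *_) b≡0) (zeroʳ a)))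
  ... | inj₁ r≡1  = r≢1 r≡1
  ... | inj₂ r≡-1 = r≢-1 r≡-1

  c≢0 : r ≢ 1# - a → r ≢ - 1# - a → c ≢ 0#
  c≢0 r≢1-a r≢-1-a c≡0 with x*x≡1⇒x≡±1 (a + r) [a+r]²≡1
    where
    ac≡[a+r]²-1 : a * c ≡ (a + r) * (a + r) - 1#
    ac≡[a+r]²-1 = begin
      a * c
        ≡⟨ solve 3 (λ a b r → a :* (a :+ b :+ κ 2 :* r) := a :* a :+ a :* b :+ κ 2 :* a :* r)
                   refl a b r ⟩
      a * a + a * b + # 2 * a * r
        ≡⟨ cong (λ s → a * a + s + # 2 * a * r) ab≡r²-1 ⟩
      a * a + (r * r - 1#) + # 2 * a * r
        ≡⟨ solve 2 (λ a r → a :* a :+ (r :* r :- 𝟙) :+ κ 2 :* a :* r := (a :+ r) :* (a :+ r) :- 𝟙)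
                   refl a r ⟩
      (a + r) * (a + r) - 1#
        ∎
    [a+r]²≡1 : (a + r) * (a + r) ≡ 1#
    [a+r]²≡1 = x∙y⁻¹≈ε⇒x≈y _ 1#
                 (trans (sym ac≡[a+r]²-1) (trans (cong (a *_) c≡0) (zeroʳ a)))
  ... | inj₁ a+r≡1  = r≢1-a (x+y≡z⇒y≡z-x a+r≡1)
  ... | inj₂ a+r≡-1 = r≢-1-a (x+y≡z⇒y≡z-x a+r≡-1)

  a₂≡l²-1 : a * b + b * c + a * c ≡ l * l - 1#
  a₂≡l²-1 = begin
    a * b + b * c + a * c
      ≡⟨ solve 3 (λ a b r → let c = a :+ b :+ κ 2 :* r ; l = a :+ b :+ r in
                   a :* b :+ b :* c :+ a :* c := l :* l :- r :* r :+ a :* b) refl a b r ⟩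
    l * l - r * r + a * b
      ≡⟨ cong (λ s → l * l - r * r + s) ab≡r²-1 ⟩
    l * l - r * r + (r * r - 1#)
      ≡⟨ solve 2 (λ l r → l :* l :- r :* r :+ (r :* r :- 𝟙) := l :* l :- 𝟙) refl l r ⟩
    l * l - 1#
      ∎

  a₄≡2yl : a * b * (b * c) + b * c * (a * c) + a * c * (a * b) ≡ # 2 * y * l
  a₄≡2yl = solve 3 (λ a b r → let c = a :+ b :+ κ 2 :* r in
                      a :* b :* (b :* c) :+ b :* c :* (a :* c) :+ a :* c :* (a :* b)
                      := κ 2 :* (a :* b :* c) :* (a :+ b :+ r)) refl a b r

  -- a² (x(3P) - 1) as a polynomial in a, r and s = ab, using ay = s·ac and ac = a² + s + 2ar.
  Φ : Carrier → Carrier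
  Φ s = # 4 * s * ac * (a * a + s + a * r + s * ac) - a * a
    where
    ac : Carrier
    ac = a * a + s + # 2 * a * r

  torsionPolynomial≡a²[x₃-1] : torsionPolynomial ≡ a * a * (x₃ - 1#)
  torsionPolynomial≡a²[x₃-1] = begin
    torsionPolynomial   ≡⟨ solve 2 (λ a r → polynomial a r := Φ′ a r (r :* r :- 𝟙)) refl a r ⟩
    Φ (r * r - 1#)      ≡⟨ cong Φ ab≡r²-1 ⟨
    Φ (a * b)           ≡⟨ solve 3 (λ a b r → Φ′ a r (a :* b) := a :* a :* (x₃′ a b r :- 𝟙))
                                   refl a b r ⟩
    a * a * (x₃ - 1#)   ∎
    where
    Φ′ : ∀ {n} → Polynomial n → Polynomial n → Polynomial n → Polynomial n
    Φ′ {n} a r s = κ 4 :* s :* ac :* (a :* a :+ s :+ a :* r :+ s :* ac) :- a :* a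
      where
      ac : Polynomial n
      ac = a :* a :+ s :+ κ 2 :* a :* r
    x₃′ : ∀ {n} → Polynomial n → Polynomial n → Polynomial n → Polynomial n
    x₃′ a b r = let y = a :* b :* (a :+ b :+ κ 2 :* r) in κ 4 :* y :* ((a :+ b :+ r) :+ y)
    polynomial : ∀ {n} → Polynomial n → Polynomial n → Polynomial n
    polynomial {n} a r =
          (:- (κ 4 :* r²) :+ κ 4 :* r⁴) :* a⁴
       :+ (κ 4 :* r :- κ 20 :* r³ :+ κ 16 :* r⁵) :* a³
       :+ (:- 𝟙 :+ κ 16 :* r² :- κ 40 :* r⁴ :+ κ 24 :* r⁶) :* a²
       :+ (:- (κ 4 :* r) :+ κ 24 :* r³ :- κ 36 :* r⁵ :+ κ 16 :* r⁷) :* a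
       :- κ 4 :* r² :+ κ 12 :* r⁴ :- κ 12 :* r⁶ :+ κ 4 :* r⁸
      where
      r² r³ r⁴ r⁵ r⁶ r⁷ r⁸ a² a³ a⁴ : Polynomial n
      r² = r :* r ; r³ = r² :* r ; r⁴ = r³ :* r ; r⁵ = r⁴ :* r
      r⁶ = r⁵ :* r ; r⁷ = r⁶ :* r ; r⁸ = r⁷ :* r
      a² = a :* a ; a³ = a² :* a ; a⁴ = a³ :* a

  torsionPolynomial≡0⇔x₃≡1 : torsionPolynomial ≡ 0# ⇔ x₃ ≡ 1#
  torsionPolynomial≡0⇔x₃≡1 = mk⇔ to from
    where
    to : torsionPolynomial ≡ 0# → x₃ ≡ 1#
    to poly≡0 = x∙y⁻¹≈ε⇒x≈y _ 1#
                  (x*y≡0⇒y≡0 (*-≢0 a≢0 a≢0) (trans (sym torsionPolynomial≡a²[x₃-1]) poly≡0))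
    from : x₃ ≡ 1# → torsionPolynomial ≡ 0#
    from x₃≡1 = begin
      torsionPolynomial    ≡⟨ torsionPolynomial≡a²[x₃-1] ⟩
      a * a * (x₃ - 1#)    ≡⟨ cong (λ x → a * a * (x - 1#)) x₃≡1 ⟩
      a * a * (1# - 1#)    ≡⟨ solve 1 (λ a → a :* a :* (𝟙 :- 𝟙) := κ 0) refl a ⟩
      0#                   ∎

  E′-5P≡𝒪⇔x₃≡1 : y ≢ 0# → smul (a * b) (b * c) (a * c) 5 (pt 0# y) ≡ 𝒪 ⇔ x₃ ≡ 1#
  E′-5P≡𝒪⇔x₃≡1 y≢0 = subst (λ Q → Q ≡ 𝒪 ⇔ x₃ ≡ 1#) (sym E′≡)
                            (FiveTorsion.5P≡𝒪⇔x₃≡1 isField a₆ y l y≢0)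
    where
    a₆ : Carrier
    a₆ = a * b * (b * c) * (a * c)
    5P-on : Carrier → Carrier → Point
    5P-on a₂ a₄ = let open Weierstrass F a₂ a₄ a₆; P = pt 0# y in P ⊕ P ⊕ P ⊕ P ⊕ P
    E′≡ : smul (a * b) (b * c) (a * c) 5 (pt 0# y) ≡ 5P-on (l * l - 1#) (# 2 * y * l)
    E′≡ = cong₂ 5P-on a₂≡l²-1 a₄≡2yl

lemma1Over : {F : FieldOps} → IsField F → Lemma1Over F
lemma1Over {F} isField a r a≢0 r≢1 r≢-1 r≢1-a r≢-1-a _ _ _ =
  Equivalence.to 5P≡𝒪⇔poly≡0 , Equivalence.from 5P≡𝒪⇔poly≡0
  where
  open FieldOps F
  open EC F using (𝒪; pt; smul)
  open FieldProperties isField using (*-≢0)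
  open DiophantineCurve isField a r a≢0
  y≢0 : y ≢ 0#
  y≢0 = *-≢0 (*-≢0 a≢0 (b≢0 r≢1 r≢-1)) (c≢0 r≢1-a r≢-1-a)
  5P≡𝒪⇔poly≡0 : smul (a * b) (b * c) (a * c) 5 (pt 0# y) ≡ 𝒪 ⇔ torsionPolynomial ≡ 0#
  5P≡𝒪⇔poly≡0 = ⇔-trans (E′-5P≡𝒪⇔x₃≡1 y≢0) (⇔-sym torsionPolynomial≡0⇔x₃≡1)

invℚ-inverseʳ : ∀ p → p ≢ 0ℚ → p ℚ.* invℚ p ≡ 1ℚ
invℚ-inverseʳ p p≢0 with p ℚ.≟ 0ℚ
... | yes p≡0 = contradiction p≡0 p≢0
... | no p≢0′ = ℚ.*-inverseʳ p {{ℚ.≢-nonZero p≢0′}}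

ℚ-isField : IsField ℚ-field
ℚ-isField = record
  { isCommutativeRing = ℚ.+-*-isCommutativeRing
  ; *-inverseʳ        = invℚ-inverseʳ
  ; 2≢0               = λ ()
  }

module QuadraticField (d : ℚ) where

  open FieldOps ℚ[√ d ]
  open +-*-Solver using (solve; _:=_; _:+_; _:*_; _:-_; :-_; con)
  open ≡-Reasoning

  module ℚF = FieldProperties ℚ-isField

  +-assoc : ∀ x y z → (x + y) + z ≡ x + (y + z)
  +-assoc (a , b) (c , e) (f , g) = cong₂ _,_ (ℚ.+-assoc a c f) (ℚ.+-assoc b e g)

  +-comm : ∀ x y → x + y ≡ y + x
  +-comm (a , b) (c , e) = cong₂ _,_ (ℚ.+-comm a c) (ℚ.+-comm b e)

  +-identityˡ : ∀ x → 0# + x ≡ x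
  +-identityˡ (a , b) = cong₂ _,_ (ℚ.+-identityˡ a) (ℚ.+-identityˡ b)

  +-identityʳ : ∀ x → x + 0# ≡ x
  +-identityʳ (a , b) = cong₂ _,_ (ℚ.+-identityʳ a) (ℚ.+-identityʳ b)

  -‿inverseˡ : ∀ x → (- x) + x ≡ 0#
  -‿inverseˡ (a , b) = cong₂ _,_ (ℚ.+-inverseˡ a) (ℚ.+-inverseˡ b)

  -‿inverseʳ : ∀ x → x + (- x) ≡ 0#
  -‿inverseʳ (a , b) = cong₂ _,_ (ℚ.+-inverseʳ a) (ℚ.+-inverseʳ b)

  *-assoc : ∀ x y z → (x * y) * z ≡ x * (y * z)
  *-assoc (a , b) (c , e) (f , g) = cong₂ _,_
    (solve 7 (λ d a b c e f g →
                (a :* c :+ d :* (b :* e)) :* f :+ d :* ((a :* e :+ b :* c) :* g)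
                := a :* (c :* f :+ d :* (e :* g)) :+ d :* (b :* (c :* g :+ e :* f)))
             refl d a b c e f g)
    (solve 7 (λ d a b c e f g →
                (a :* c :+ d :* (b :* e)) :* g :+ (a :* e :+ b :* c) :* f
                := a :* (c :* g :+ e :* f) :+ b :* (c :* f :+ d :* (e :* g)))
             refl d a b c e f g)

  *-comm : ∀ x y → x * y ≡ y * x
  *-comm (a , b) (c , e) = cong₂ _,_
    (solve 5 (λ d a b c e → a :* c :+ d :* (b :* e) := c :* a :+ d :* (e :* b)) refl d a b c e)
    (solve 4 (λ a b c e → a :* e :+ b :* c := c :* b :+ e :* a) refl a b c e)

  *-identityˡ : ∀ x → 1# * x ≡ x
  *-identityˡ (a , b) = cong₂ _,_
    (solve 3 (λ d a b → con 1ℚ :* a :+ d :* (con 0ℚ :* b) := a) refl d a b)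
    (solve 2 (λ a b → con 1ℚ :* b :+ con 0ℚ :* a := b) refl a b)

  *-identityʳ : ∀ x → x * 1# ≡ x
  *-identityʳ x = trans (*-comm x 1#) (*-identityˡ x)

  *-distribˡ-+ : ∀ x y z → x * (y + z) ≡ (x * y) + (x * z)
  *-distribˡ-+ (a , b) (c , e) (f , g) = cong₂ _,_
    (solve 7 (λ d a b c e f g →
                a :* (c :+ f) :+ d :* (b :* (e :+ g))
                := (a :* c :+ d :* (b :* e)) :+ (a :* f :+ d :* (b :* g)))
             refl d a b c e f g)
    (solve 6 (λ a b c e f g → a :* (e :+ g) :+ b :* (c :+ f)
                            := (a :* e :+ b :* c) :+ (a :* g :+ b :* f)) refl a b c e f g)

  *-distribʳ-+ : ∀ x y z → (y + z) * x ≡ (y * x) + (z * x)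
  *-distribʳ-+ x y z =
    trans (*-comm (y + z) x) (trans (*-distribˡ-+ x y z) (cong₂ _+_ (*-comm x y) (*-comm x z)))

  isCommutativeRing : IsCommutativeRing _≡_ _+_ _*_ -_ 0# 1#
  isCommutativeRing = record
    { isRing = record
      { +-isAbelianGroup = record
        { isGroup = record
          { isMonoid = record
            { isSemigroup = record
              { isMagma = record { isEquivalence = isEquivalence ; ∙-cong = cong₂ _+_ }
              ; assoc = +-assoc }
            ; identity = +-identityˡ , +-identityʳ }
          ; inverse = -‿inverseˡ , -‿inverseʳ
          ; ⁻¹-cong = cong (λ x → - x) }
        ; comm = +-comm }
      ; *-cong = cong₂ _*_
      ; *-assoc = *-assoc
      ; *-identity = *-identityˡ , *-identityʳ
      ; distrib = *-distribˡ-+ , *-distribʳ-+ }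
    ; *-comm = *-comm }

  norm : ℚ → ℚ → ℚ
  norm a b = a ℚ.* a ℚ.- d ℚ.* (b ℚ.* b)

  module _ (nonSquare : NonSquare d) where

    norm≡0⇒≡0 : ∀ a b → norm a b ≡ 0ℚ → (a , b) ≡ 0#
    norm≡0⇒≡0 a b norm≡0 with b ℚ.≟ 0ℚ
    ... | yes b≡0 = cong₂ _,_ (reduce (ℚF.x*y≡0⇒x≡0⊎y≡0 a a a²≡0)) b≡0
      where
      a²≡0 : a ℚ.* a ≡ 0ℚ
      a²≡0 = begin
        a ℚ.* a     ≡⟨ solve 2 (λ a d → a :* a := a :* a :- d :* (con 0ℚ :* con 0ℚ)) refl a d ⟩
        norm a 0ℚ   ≡⟨ cong (norm a) b≡0 ⟨
        norm a b    ≡⟨ norm≡0 ⟩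
        0ℚ          ∎
    ... | no b≢0 = contradiction (a ℚ.* b⁻¹ , [a/b]²≡d) nonSquare
      where
      b⁻¹ : ℚ
      b⁻¹ = invℚ b
      [a/b]²≡d : (a ℚ.* b⁻¹) ℚ.* (a ℚ.* b⁻¹) ≡ d
      [a/b]²≡d = begin
        (a ℚ.* b⁻¹) ℚ.* (a ℚ.* b⁻¹)
          ≡⟨ solve 4 (λ a b d i → (a :* i) :* (a :* i)
                        := (a :* a :- d :* (b :* b)) :* (i :* i) :+ d :* ((b :* i) :* (b :* i)))
                     refl a b d b⁻¹ ⟩
        norm a b ℚ.* (b⁻¹ ℚ.* b⁻¹) ℚ.+ d ℚ.* ((b ℚ.* b⁻¹) ℚ.* (b ℚ.* b⁻¹))
          ≡⟨ cong₂ (λ n u → n ℚ.* (b⁻¹ ℚ.* b⁻¹) ℚ.+ d ℚ.* (u ℚ.* u))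
                   norm≡0 (invℚ-inverseʳ b b≢0) ⟩
        0ℚ ℚ.* (b⁻¹ ℚ.* b⁻¹) ℚ.+ d ℚ.* (1ℚ ℚ.* 1ℚ)
          ≡⟨ solve 2 (λ d i → con 0ℚ :* (i :* i) :+ d :* (con 1ℚ :* con 1ℚ) := d) refl d b⁻¹ ⟩
        d
          ∎

    *-inverseʳ : ∀ x → x ≢ 0# → x * inv x ≡ 1#
    *-inverseʳ (a , b) x≢0 = cong₂ _,_
      (trans (solve 4 (λ a b d i → a :* (a :* i) :+ d :* (b :* ((:- b) :* i))
                                   := (a :* a :- d :* (b :* b)) :* i) refl a b d N⁻¹)
             (invℚ-inverseʳ (norm a b) (x≢0 ∘ norm≡0⇒≡0 a b)))
      (solve 3 (λ a b i → a :* ((:- b) :* i) :+ b :* (a :* i) := con 0ℚ) refl a b N⁻¹)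
      where
      N⁻¹ : ℚ
      N⁻¹ = invℚ (norm a b)

    isField : IsField ℚ[√ d ]
    isField = record
      { isCommutativeRing = isCommutativeRing
      ; *-inverseʳ        = *-inverseʳ
      ; 2≢0               = λ ()
      }

lemma1 : Lemma1Over ℚ-field × ((d : ℚ) → NonSquare d → Lemma1Over ℚ[√ d ])
lemma1 = lemma1Over ℚ-isField , λ d nonSquare → lemma1Over (QuadraticField.isField d nonSquare)
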